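{- For every integer $n>0$ there is a first order formula $\varphi_n$ with $\mathrm{fotw}(\varphi_n)=n$ and $\mathrm{tw}(G_{\varphi_n})=1$.
   Context: Formulae are of relational first-order logic with constants, in negation normal form, and straight: no variable is quantified twice, no free variable is also quantified, every quantified variable occurs in some atom (non-straight formulae are first made straight by renaming bound variables). $\mathrm{var}(\varphi)$ is the set of variables of $\varphi$. The formula graph $G_\varphi$ has vertex set $\mathrm{var}(\varphi)$ and an edge $\{x,y\}$ ($x\neq y$) whenever $x,y$ are both free in $\varphi$ or occur together in some atom. For a bound variable $x$, $Q_x\in\{\exists,\forall\}$ is its quantifier and its scope is the subformula $\psi$ with $Q_xx\psi$ a subformula of $\varphi$. For bound $x,y$, $x\le_\varphi y$ means $x=y$ or $y$ is quantified in the scope of $x$. For a set $X$ of variables, $\varphi_{[X]}$ is the minimal (w.r.t. subformulaship) subformula of $\varphi$ containing all atoms using variables from $X$. For a binary relation $\trianglelefteq$ on $\mathrm{var}(\varphi)$, $x,y$ are entangled w.r.t. $\trianglelefteq$ and $\varphi$ if $x$ occurs in $\varphi_{[\{z: y\trianglelefteq z\}]}$ and $y$ occurs in $\varphi_{[\{z:x\trianglelefteq z\}]}$. $\preceq_\varphi$ is the smallest binary relation on $\mathrm{var}(\varphi)$ that is reflexive, transitive, and satisfies: if $x\le_\varphi y$, $Q_x\ne Q_y$, and there is a sequence $x=z_0,\dots,z_n=y$ of bound variables such that for all $0\le i<n$, $z_i,z_{i+1}$ are entangled w.r.t. $\preceq_\varphi$ and $\varphi$ and ($x\preceq_\varphi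 z_i$ or $y\preceq_\varphi z_i$), then $x\preceq_\varphi y$. The essential alternation depth $\mathrm{ead}_\varphi(x)$ is $0$ for free $x$; for bound $x$ it is the maximum over all sequences $v_1,\dots,v_m=x$ with $v_i\preceq_\varphi v_{i+1}$, $v_i\ne v_{i+1}$, of the number of indices $i$ with $Q_{v_i}\ne Q_{v_{i+1}}$, plus $1$ if $Q_{v_1}=\exists$ and plus $2$ if $Q_{v_1}=\forall$. A tree decomposition $(T,B)$ of a graph $G$ (rooted tree $T$, pieces $B_t\subseteq V(G)$ covering all vertices and edges, with $\{t:v\in B_t\}$ connected for each $v$; width $\max|B_t|-1$) is $d$-stratified for $d\colon V(G)\to\mathbb N$ if $t_u<_Tt_v$ implies $d(u)\le d(v)$, where $t_v$ is the node closest to the root whose piece contains $v$ and $<_T$ is the tree order with root smallest. $\mathrm{tw}(G,d)$ is the minimum width of a $d$-stratified tree decomposition, $\mathrm{tw}(G)$ the usual tree-width, and $\mathrm{fotw}(\varphi):=\mathrm{tw}(G_\varphi,\mathrm{ead}_\varphi)$. -}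

module Defs where

open import Data.Nat using (ℕ; zero; suc; _+_; _≤_; _<_; _⊔_; _∸_)
open import Data.List using (List; []; _∷_; _++_; length; map; foldr; upTo)
open import Data.List.Membership.Propositional using (_∈_)
open import Data.List.Relation.Unary.Unique.Propositional using (Unique)
open import Data.Product using (Σ; ∃; _×_; _,_)
open import Data.Sum using (_⊎_)
open import Relation.Binary.PropositionalEquality using (_≡_; _≢_)
open import Relation.Nullary using (¬_)

-- Syntax: relational first-order logic with constants, in negation
-- normal form.  Variables, constants and relation symbols are natural
-- numbers (equality, if wanted, is just one of the relation symbols).

data Term : Set where
  var : ℕ → Term
  con : ℕ → Term

data Pol : Set where
  pos neg : Pol

data Conn : Set where
  and or : Conn

data Quant : Set where
  ex all : Quant

data Fml : Set where
  lit : Pol → ℕ → List Term → Fml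
  bin : Conn → Fml → Fml → Fml
  qu  : Quant → ℕ → Fml → Fml

data Dir : Set where
  left right down : Dir

data SubAt : Fml → List Dir → Fml → Set where
  here : ∀ {φ} → SubAt φ [] φ
  inL  : ∀ {c a b p ψ} → SubAt a p ψ → SubAt (bin c a b) (left ∷ p) ψ
  inR  : ∀ {c a b p ψ} → SubAt b p ψ → SubAt (bin c a b) (right ∷ p) ψ
  inQ  : ∀ {q x a p ψ} → SubAt a p ψ → SubAt (qu q x a) (down ∷ p) ψ

-- prefix order on positions (p ⊑ q: occurrence q lies inside occurrence p)
_⊑_ : List Dir → List Dir → Set
p ⊑ q = ∃ λ r → p ++ r ≡ q

AtomAt : Fml → List Dir → List Term → Set
AtomAt φ p ts = ∃ λ s → ∃ λ R → SubAt φ p (lit s R ts)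

data Occurs (x : ℕ) : Fml → Set where
  inLit : ∀ {s R ts} → var x ∈ ts → Occurs x (lit s R ts)
  inBL  : ∀ {c a b} → Occurs x a → Occurs x (bin c a b)
  inBR  : ∀ {c a b} → Occurs x b → Occurs x (bin c a b)
  isQ   : ∀ {q a} → Occurs x (qu q x a)
  inQ   : ∀ {q y a} → Occurs x a → Occurs x (qu q y a)

data FreeIn (x : ℕ) : Fml → Set where
  inLit : ∀ {s R ts} → var x ∈ ts → FreeIn x (lit s R ts)
  inBL  : ∀ {c a b} → FreeIn x a → FreeIn x (bin c a b)
  inBR  : ∀ {c a b} → FreeIn x b → FreeIn x (bin c a b)
  inQ   : ∀ {q y a} → x ≢ y → FreeIn x a → FreeIn x (qu q y a)

QOf : Fml → ℕ → Quant → Set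
QOf φ x q = ∃ λ p → ∃ λ ψ → SubAt φ p (qu q x ψ)

Bound : Fml → ℕ → Set
Bound φ x = ∃ λ q → QOf φ x q

Var : Fml → ℕ → Set
Var φ x = Occurs x φ

Straight : Fml → Set
Straight φ =
    (∀ x p p' q q' ψ ψ' → SubAt φ p (qu q x ψ) → SubAt φ p' (qu q' x ψ') → p ≡ p')
  × (∀ x → FreeIn x φ → ¬ Bound φ x)
  × (∀ x → Bound φ x → ∃ λ p → ∃ λ ts → AtomAt φ p ts × var x ∈ ts)

_≤[_]_ : ℕ → Fml → ℕ → Set
x ≤[ φ ] y = x ≡ y ⊎ (∃ λ p → ∃ λ q → ∃ λ ψ → SubAt φ p (qu q x ψ) × Bound ψ y)

AtomUsing : Fml → (ℕ → Set) → List Dir → Set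
AtomUsing φ X p = ∃ λ ts → AtomAt φ p ts × ∃ λ z → X z × var z ∈ ts

-- p is the position of φ_[X]: the minimal subformula (occurrence)
-- containing all atoms using variables from X, i.e. the deepest
-- position that is a common prefix of all those atom positions
IsSubX : Fml → (ℕ → Set) → List Dir → Set
IsSubX φ X p =
    (∀ q → AtomUsing φ X q → p ⊑ q)
  × (∀ p' → (∀ q → AtomUsing φ X q → p' ⊑ q) → p' ⊑ p)

OccIn : Fml → (ℕ → Set) → ℕ → Set
OccIn φ X x = ∃ λ p → IsSubX φ X p × ∃ λ ψ → SubAt φ p ψ × Occurs x ψ

Entangled : Fml → (ℕ → ℕ → Set) → ℕ → ℕ → Set
Entangled φ R x y = OccIn φ (λ z → R y z) x × OccIn φ (λ z → R x z) y

-- sequence x = z₀,…,zₙ = y of bound variables with z_i, z_{i+1}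
-- entangled and (x ⊴ z_i or y ⊴ z_i) for i < n.
-- EPath φ R x y a : such a sequence starting at a (ending at y)
data EPath (φ : Fml) (R : ℕ → ℕ → Set) (x y : ℕ) : ℕ → Set where
  end  : Bound φ y → EPath φ R x y y
  step : ∀ {a b} → Bound φ a → Entangled φ R a b → (R x a ⊎ R y a)
       → EPath φ R x y b → EPath φ R x y a

Closed : Fml → (ℕ → ℕ → Set) → Set
Closed φ R =
    (∀ x → R x x)
  × (∀ x y z → R x y → R y z → R x z)
  × (∀ x y qx qy → x ≤[ φ ] y → QOf φ x qx → QOf φ y qy → qx ≢ qy
       → EPath φ R x y x → R x y)

_⪯[_]_ : ℕ → Fml → ℕ → Set₁
x ⪯[ φ ] y = ∀ (R : ℕ → ℕ → Set) → Closed φ R → R x y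

-- Essential alternation depth (as a relation: Ead φ x e  ⇔  ead_φ(x) = e)

alt : Quant → Quant → ℕ
alt ex  ex  = 0
alt all all = 0
alt ex  all = 1
alt all ex  = 1

bonus : Quant → ℕ
bonus ex  = 1
bonus all = 2

data Chain (φ : Fml) : ℕ → ℕ → ℕ → Set₁ where
  one  : ∀ {x} → Chain φ x x 0
  step : ∀ {v w x k qv qw} → v ⪯[ φ ] w → v ≢ w → QOf φ v qv → QOf φ w qw
       → Chain φ w x k → Chain φ v x (alt qv qw + k)

Ead : Fml → ℕ → ℕ → Set₁
Ead φ x e =
    (FreeIn x φ × e ≡ 0)
  ⊎ (Bound φ x
     × (∃ λ v → ∃ λ q → ∃ λ k → QOf φ v q × Chain φ v x k × e ≡ k + bonus q)
     × (∀ v q k → QOf φ v q → Chain φ v x k → k + bonus q ≤ e))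

record Graph : Set₁ where
  field
    V : ℕ → Set
    E : ℕ → ℕ → Set

G : Fml → Graph
G φ = record
  { V = Var φ
  ; E = λ x y → x ≢ y × ((FreeIn x φ × FreeIn y φ)
                        ⊎ (∃ λ p → ∃ λ ts → AtomAt φ p ts × var x ∈ ts × var y ∈ ts)) }

-- Rooted trees and tree decompositions.
-- A rooted tree with `nodes` (≥ 1) nodes is given by nodes 0,…,nodes-1,
-- root 0, and a parent function with parent t < t for every non-root t.

module _ (parent : ℕ → ℕ) where
  Adj : ℕ → ℕ → Set
  Adj a b = (0 < b × parent b ≡ a) ⊎ (0 < a × parent a ≡ b)

  data Reach (S : ℕ → Set) : ℕ → ℕ → Set where
    here : ∀ {a} → Reach S a a
    step : ∀ {a b c} → Adj a b → S b → Reach S b c → Reach S a c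

  data Anc : ℕ → ℕ → Set where
    here : ∀ {u} → Anc u u
    up   : ∀ {u v} → 0 < v → Anc u (parent v) → Anc u v

  -- distance to the root (fuel argument; fuel t suffices since parent t < t)
  depthF : ℕ → ℕ → ℕ
  depthF zero    t       = 0
  depthF (suc f) zero    = 0
  depthF (suc f) (suc t) = suc (depthF f (parent (suc t)))

  depth : ℕ → ℕ
  depth t = depthF t t

record TreeDec (Gr : Graph) : Set where
  open Graph Gr
  field
    nodes   : ℕ
    nonempty : 0 < nodes
    parent  : ℕ → ℕ
    parent< : ∀ t → 0 < t → t < nodes → parent t < t
    bag     : ℕ → List ℕ
    bag-unique : ∀ t → Unique (bag t)
    bag⊆V   : ∀ t → t < nodes → ∀ v → v ∈ bag t → V v
    cover-V : ∀ v → V v → ∃ λ t → t < nodes × v ∈ bag t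
    cover-E : ∀ u v → E u v → ∃ λ t → t < nodes × u ∈ bag t × v ∈ bag t
    connected : ∀ v s t → s < nodes → t < nodes → v ∈ bag s → v ∈ bag t
              → Reach parent (λ r → r < nodes × v ∈ bag r) s t

  width : ℕ
  width = foldr _⊔_ 0 (map (λ t → length (bag t)) (upTo nodes)) ∸ 1

  Top : ℕ → ℕ → Set
  Top v t = t < nodes × v ∈ bag t
          × (∀ t' → t' < nodes → v ∈ bag t' → depth parent t ≤ depth parent t')

  _<T_ : ℕ → ℕ → Set
  u <T v = Anc parent u v × u ≢ v

  -- d-stratified, for d given as a (functional) relation D v n ⇔ d(v) = n
  Stratified : (ℕ → ℕ → Set₁) → Set₁
  Stratified D = ∀ u v tu tv → Top u tu → Top v tv → tu <T tv
               → ∀ a b → D u a → D v b → a ≤ b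

TwIs : Graph → ℕ → Set
TwIs Gr n = (Σ (TreeDec Gr) λ T → TreeDec.width T ≡ n)
          × (∀ (T : TreeDec Gr) → n ≤ TreeDec.width T)

TwStratIs : Graph → (ℕ → ℕ → Set₁) → ℕ → Set₁
TwStratIs Gr D n = (Σ (TreeDec Gr) λ T → TreeDec.Stratified T D × TreeDec.width T ≡ n)
                 × (∀ (T : TreeDec Gr) → TreeDec.Stratified T D → n ≤ TreeDec.width T)

FotwIs : Fml → ℕ → Set₁
FotwIs φ n = TwStratIs (G φ) (Ead φ) n

-- With x_i the variable i, φ_m := ∃x_{m+1} … ∃x_1 ∀x_0 ⋀_{i ≤ m+1} R(x_i, x_0) has a star
-- with centre x_0 as its graph, so its tree-width is 1.  The relation "x = y or y = x_0" is
-- closed under the rules defining ⪯, so every ⪯-chain is trivial except for a last step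
-- into x_0; hence ead(x_0) = 2 while ead(x_i) = 1 for the leaves.  In an ead-stratified
-- decomposition no leaf can then first appear strictly below the top bag of x_0, and since
-- the bags of a leaf form a subtree meeting the subtree of x_0, every leaf lies in that top
-- bag, which thus has m + 2 elements.  The single-bag decomposition is stratified, so
-- fotw(φ_m) = m + 1.

module Submission where

open import Defs
open import Data.Empty using (⊥-elim)
open import Data.List using (List; []; _∷_; _++_; length; map; foldr; upTo; downFrom; filter; replicate)
open import Data.List.Extrema.Nat using (argmin; argmin-all; f[argmin]≤f[xs])
open import Data.List.Membership.Propositional using (_∈_)
open import Data.List.Membership.Propositional.Properties using (∈-upTo⁺; ∈-upTo⁻; ∈-downFrom⁺; ∈-downFrom⁻; ∈-filter⁺; ∈-filter⁻)
open import Data.List.Properties using (++-identityʳ; length-downFrom)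
open import Data.List.Relation.Binary.Subset.Propositional using (_⊆_)
open import Data.List.Relation.Unary.All as All using ([]; _∷_)
open import Data.List.Relation.Unary.AllPairs using ([]; _∷_)
open import Data.List.Relation.Unary.Any using (here; there)
open import Data.List.Relation.Unary.Unique.Propositional using (Unique)
open import Data.List.Relation.Unary.Unique.Propositional.Properties using (downFrom⁺)
open import Data.Nat using (ℕ; zero; suc; _+_; _≤_; _<_; _∸_; _⊔_; z≤n; s≤s; z<s; _≟_)
open import Data.Nat.Properties
open import Data.List.Membership.DecPropositional _≟_ using (_∈?_)
open import Data.Product using (Σ; ∃; _×_; _,_; proj₁; proj₂)
open import Data.Sum using (_⊎_; inj₁; inj₂)
open import Function using (_∘_)
open import Relation.Nullary using (¬_; yes; no)
open import Relation.Binary.PropositionalEquality using (_≡_; _≢_; refl; sym; trans; cong; subst; ≢-sym)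

foldr-⊔-upper : ∀ (f : ℕ → ℕ) {x xs} → x ∈ xs → f x ≤ foldr _⊔_ 0 (map f xs)
foldr-⊔-upper f (here refl)         = m≤m⊔n (f _) _
foldr-⊔-upper f {xs = y ∷ _} (there x∈) = ≤-trans (foldr-⊔-upper f x∈) (m≤n⊔m (f y) _)

foldr-⊔-const : ∀ c (xs : List ℕ) → foldr _⊔_ 0 (map (λ _ → c) xs) ≤ c
foldr-⊔-const c []       = z≤n
foldr-⊔-const c (_ ∷ xs) = ⊔-lub ≤-refl (foldr-⊔-const c xs)

remove : ∀ {y : ℕ} xs → y ∈ xs → List ℕ
remove (_ ∷ xs) (here _)   = xs
remove (x ∷ xs) (there y∈) = x ∷ remove xs y∈

length-remove : ∀ {y : ℕ} xs (y∈ : y ∈ xs) → suc (length (remove xs y∈)) ≡ length xs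
length-remove (_ ∷ _)  (here _)   = refl
length-remove (_ ∷ xs) (there y∈) = cong suc (length-remove xs y∈)

∈-remove⁺ : ∀ {y z : ℕ} xs (y∈ : y ∈ xs) → z ∈ xs → z ≢ y → z ∈ remove xs y∈
∈-remove⁺ (_ ∷ _)  (here refl) (here refl) z≢y = ⊥-elim (z≢y refl)
∈-remove⁺ (_ ∷ _)  (here _)    (there z∈)  _   = z∈
∈-remove⁺ (_ ∷ _)  (there _)   (here z≡)   _   = here z≡
∈-remove⁺ (_ ∷ xs) (there y∈)  (there z∈)  z≢y = there (∈-remove⁺ xs y∈ z∈ z≢y)

Unique-⊆⇒length≤ : ∀ {xs ys : List ℕ} → Unique xs → xs ⊆ ys → length xs ≤ length ys
Unique-⊆⇒length≤ {[]}     _            _    = z≤n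
Unique-⊆⇒length≤ {y ∷ xs} {ys} (y∉xs ∷ u) xs⊆ys =
  subst (suc (length xs) ≤_) (length-remove ys y∈ys)
    (s≤s (Unique-⊆⇒length≤ u λ z∈ → ∈-remove⁺ ys y∈ys (xs⊆ys (there z∈)) (≢-sym (All.lookup y∉xs z∈))))
  where y∈ys = xs⊆ys (here refl)

module _ {Gr : Graph} (T : TreeDec Gr) where
  open Graph Gr
  open TreeDec T

  Unique-⊆bag⇒≤width : ∀ {t xs} → t < nodes → Unique xs → xs ⊆ bag t → length xs ∸ 1 ≤ width
  Unique-⊆bag⇒≤width t< u xs⊆ = ∸-monoˡ-≤ 1 (≤-trans (Unique-⊆⇒length≤ u xs⊆)
    (foldr-⊔-upper (λ t → length (bag t)) (∈-upTo⁺ t<)))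

  depthF-root : ∀ f → depthF parent f 0 ≡ 0
  depthF-root zero    = refl
  depthF-root (suc f) = refl

  depthF-fuel : ∀ {f g t} → t ≤ f → t ≤ g → t < nodes → depthF parent f t ≡ depthF parent g t
  depthF-fuel {f} {g} {zero} _ _ _ = trans (depthF-root f) (sym (depthF-root g))
  depthF-fuel {suc f} {suc g} {suc t} (s≤s t≤f) (s≤s t≤g) t< =
    cong suc (depthF-fuel (≤-trans p≤t t≤f) (≤-trans p≤t t≤g) (<-trans p<t t<))
    where
    p<t = parent< (suc t) z<s t<
    p≤t = ≤-pred p<t

  depth-parent : ∀ {t} → 0 < t → t < nodes → depth parent (parent t) < depth parent t
  depth-parent {suc t} _ t< = s≤s (≤-reflexive (depthF-fuel ≤-refl (≤-pred p<t) (<-trans p<t t<)))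
    where p<t = parent< (suc t) z<s t<

  _∈Bag_ : ℕ → ℕ → Set
  v ∈Bag r = r < nodes × v ∈ bag r

  top-exists : ∀ {v t} → t < nodes → v ∈ bag t → ∃ (Top v)
  top-exists {v} {t} t< v∈t = t₀ , proj₁ t₀-holds , proj₂ t₀-holds , t₀-minimal
    where
    candidates = filter (λ r → v ∈? bag r) (upTo nodes)
    candidate-holds : ∀ {r} → r ∈ candidates → v ∈Bag r
    candidate-holds r∈ with r∈upTo , v∈r ← ∈-filter⁻ (λ r → v ∈? bag r) r∈ = ∈-upTo⁻ r∈upTo , v∈r
    t₀ = argmin (depth parent) t candidates
    t₀-holds : v ∈Bag t₀
    t₀-holds = argmin-all (depth parent) (t< , v∈t) (All.tabulate candidate-holds)
    t₀-minimal : ∀ t' → t' < nodes → v ∈ bag t' → depth parent t₀ ≤ depth parent t'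
    t₀-minimal t' t'< v∈t' = All.lookup (f[argmin]≤f[xs] {f = depth parent} t candidates)
                                        (∈-filter⁺ (λ r → v ∈? bag r) (∈-upTo⁺ t'<) v∈t')

  Reach-below-top : ∀ {v t a s} → Top v t → Anc parent t a → Reach parent (v ∈Bag_) a s → Anc parent t s
  Reach-below-top _ t≤a here = t≤a
  Reach-below-top top t≤a (step (inj₁ (0<b , refl)) _ r) = Reach-below-top top (up 0<b t≤a) r
  Reach-below-top (t< , _ , minimal) here (step (inj₂ (0<t , refl)) (p< , v∈p) _) =
    ⊥-elim (<⇒≱ (depth-parent 0<t t<) (minimal _ p< v∈p))
  Reach-below-top top (up _ t≤a) (step (inj₂ (_ , refl)) _ r) = Reach-below-top top t≤a r

  top-is-ancestor : ∀ {v t s} → Top v t → s < nodes → v ∈ bag s → Anc parent t s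
  top-is-ancestor top@(t< , v∈t , _) s< v∈s = Reach-below-top top here (connected _ _ _ t< s< v∈t v∈s)

  Reach-into-subtree : ∀ {P w a b} → Reach parent P a b → Anc parent w b → ¬ Anc parent w a → ¬ ¬ P w
  Reach-into-subtree here w≤b w≰a _ = w≰a w≤b
  Reach-into-subtree (step (inj₁ (_ , refl)) Pc r) w≤b w≰a ¬Pw =
    Reach-into-subtree r w≤b (λ { here → ¬Pw Pc ; (up _ w≤a) → w≰a w≤a }) ¬Pw
  Reach-into-subtree (step (inj₂ (0<a , refl)) _ r) w≤b w≰a ¬Pw =
    Reach-into-subtree r w≤b (w≰a ∘ up 0<a) ¬Pw

  -- If v were missing from t, then t_v could not lie below t (stratification), so the path
  -- from t_v to a bag covering the edge would enter the subtree of t, hence pass through t.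
  lower-neighbour∈top : ∀ {D u v a b t} → Stratified D → D u a → D v b → b < a
                      → Top u t → E v u → v ∈ bag t
  lower-neighbour∈top {u = u} {v} {a} {b} {t} strat Du Dv b<a top e with v ∈? bag t | cover-E v u e
  ... | yes v∈t | _ = v∈t
  ... | no v∉t | s , s< , v∈s , u∈s with top-exists s< v∈s
  ...   | tv , topv@(tv< , v∈tv , _) =
    ⊥-elim (Reach-into-subtree (connected v tv s tv< s< v∈tv v∈s) (top-is-ancestor top s< u∈s) t≰tv (v∉t ∘ proj₂))
    where
    t≰tv : ¬ Anc parent t tv
    t≰tv t≤tv with t ≟ tv
    ... | yes refl = v∉t v∈tv
    ... | no t≢tv  = <⇒≱ b<a (strat u v t tv top topv (t≤tv , t≢tv) a b Du Dv)

record Star (k : ℕ) (Gr : Graph) : Set where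
  open Graph Gr
  field
    vertex⇒≤  : ∀ {v} → V v → v ≤ k
    ≤⇒vertex  : ∀ {v} → v ≤ k → V v
    spoke     : ∀ {j} → j < k → E (suc j) 0
    edge⇒spoke : ∀ {u v} → E u v → ∃ λ j → j < k × ((u ≡ suc j × v ≡ 0) ⊎ (u ≡ 0 × v ≡ suc j))

module _ {k : ℕ} {Gr : Graph} (S : Star k Gr) where
  open Graph Gr
  open Star S

  edge-ends≤ : ∀ {u v} → E u v → u ≤ k × v ≤ k
  edge-ends≤ e with edge⇒spoke e
  ... | _ , j<k , inj₁ (refl , refl) = j<k , z≤n
  ... | _ , j<k , inj₂ (refl , refl) = z≤n , j<k

  spoke-decomposition : 0 < k → TreeDec Gr
  spoke-decomposition 0<k = record
    { nodes      = k
    ; nonempty   = 0<k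
    ; parent     = λ _ → 0
    ; parent<    = λ _ 0<t _ → 0<t
    ; bag        = λ t → 0 ∷ suc t ∷ []
    ; bag-unique = λ _ → ((λ ()) ∷ []) ∷ [] ∷ []
    ; bag⊆V      = λ { _ _ _ (here refl) → ≤⇒vertex z≤n ; _ t<k _ (there (here refl)) → ≤⇒vertex t<k }
    ; cover-V    = cover-V
    ; cover-E    = cover-E
    ; connected  = connected
    }
    where
    cover-V : ∀ v → V v → ∃ λ t → t < k × v ∈ (0 ∷ suc t ∷ [])
    cover-V zero    _  = 0 , 0<k , here refl
    cover-V (suc j) Vv = j , vertex⇒≤ Vv , there (here refl)
    cover-E : ∀ u v → E u v → ∃ λ t → t < k × u ∈ (0 ∷ suc t ∷ []) × v ∈ (0 ∷ suc t ∷ [])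
    cover-E u v e with edge⇒spoke e
    ... | j , j<k , inj₁ (refl , refl) = j , j<k , there (here refl) , here refl
    ... | j , j<k , inj₂ (refl , refl) = j , j<k , here refl , there (here refl)
    _∈Spoke_ : ℕ → ℕ → Set
    v ∈Spoke t = t < k × v ∈ (0 ∷ suc t ∷ [])
    from-root : ∀ {t} → t < k → Reach (λ _ → 0) (0 ∈Spoke_) 0 t
    from-root {zero}  _   = here
    from-root {suc t} t<k = step (inj₁ (z<s , refl)) (t<k , here refl) here
    connected : ∀ v s t → s < k → t < k → v ∈ (0 ∷ suc s ∷ []) → v ∈ (0 ∷ suc t ∷ [])
              → Reach (λ _ → 0) (v ∈Spoke_) s t
    connected _ zero    _ _ t<k (here refl) _ = from-root t<k
    connected _ (suc s) _ _ t<k (here refl) _ = step (inj₂ (z<s , refl)) (0<k , here refl) (from-root t<k)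
    connected _ _ _ _ _ (there (here refl)) (there (here refl)) = here

  single-bag : TreeDec Gr
  single-bag = record
    { nodes      = 1
    ; nonempty   = z<s
    ; parent     = λ _ → 0
    ; parent<    = λ { zero () _ ; (suc _) _ (s≤s ()) }
    ; bag        = λ _ → downFrom (suc k)
    ; bag-unique = λ _ → downFrom⁺ (suc k)
    ; bag⊆V      = λ _ _ _ v∈ → ≤⇒vertex (≤-pred (∈-downFrom⁻ v∈))
    ; cover-V    = λ _ Vv → 0 , z<s , ∈-downFrom⁺ (s≤s (vertex⇒≤ Vv))
    ; cover-E    = λ _ _ e → 0 , z<s , ∈-downFrom⁺ (s≤s (proj₁ (edge-ends≤ e)))
                                     , ∈-downFrom⁺ (s≤s (proj₂ (edge-ends≤ e)))
    ; connected  = λ { _ zero zero _ _ _ _ → here ; _ (suc _) _ (s≤s ()) _ _ _ ; _ zero (suc _) _ (s≤s ()) _ _ }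
    }

  single-bag-stratified : ∀ D → TreeDec.Stratified single-bag D
  single-bag-stratified D _ _ _ _ (s≤s z≤n , _) (s≤s z≤n , _) (_ , t≢t) = ⊥-elim (t≢t refl)

  single-bag-width : TreeDec.width single-bag ≡ k
  single-bag-width = cong (_∸ 1) (trans (⊔-identityʳ _) (length-downFrom (suc k)))

  spoke-decomposition-width : (0<k : 0 < k) → TreeDec.width (spoke-decomposition 0<k) ≡ 1
  spoke-decomposition-width 0<k = cong (_∸ 1) (≤-antisym (foldr-⊔-const 2 (upTo k))
                                            (foldr-⊔-upper (λ _ → 2) (∈-upTo⁺ 0<k)))

  1≤width : 0 < k → (T : TreeDec Gr) → 1 ≤ TreeDec.width T
  1≤width 0<k T with TreeDec.cover-E T 1 0 (spoke 0<k)
  ... | t , t< , 1∈t , 0∈t = Unique-⊆bag⇒≤width T t< (((λ ()) ∷ []) ∷ [] ∷ [])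
                               λ { (here refl) → 1∈t ; (there (here refl)) → 0∈t }

  tw-star : 0 < k → TwIs Gr 1
  tw-star 0<k = (spoke-decomposition 0<k , spoke-decomposition-width 0<k) , 1≤width 0<k

  k≤stratified-width : ∀ {D a b} → D 0 a → (∀ {j} → j < k → D (suc j) b) → b < a
                     → (T : TreeDec Gr) → TreeDec.Stratified T D → k ≤ TreeDec.width T
  k≤stratified-width {a = a} {b} D0 Dleaf b<a T strat with TreeDec.cover-V T 0 (≤⇒vertex z≤n)
  ... | t , t< , 0∈t with top-exists T t< 0∈t
  ...   | tc , top@(tc< , 0∈tc , _) =
    subst (_≤ TreeDec.width T) (cong (_∸ 1) (length-downFrom (suc k)))
      (Unique-⊆bag⇒≤width T tc< (downFrom⁺ (suc k)) all∈tc)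
    where
    all∈tc : ∀ {v} → v ∈ downFrom (suc k) → v ∈ TreeDec.bag T tc
    all∈tc {zero}  _  = 0∈tc
    all∈tc {suc j} v∈ = lower-neighbour∈top T strat D0 (Dleaf j<k) b<a top (spoke j<k)
      where j<k = ≤-pred (∈-downFrom⁻ v∈)

  stratified-tw-star : ∀ {D a b} → D 0 a → (∀ {j} → j < k → D (suc j) b) → b < a → TwStratIs Gr D k
  stratified-tw-star D0 Dleaf b<a = (single-bag , single-bag-stratified _ , single-bag-width) , k≤stratified-width D0 Dleaf b<a

AtomWith : Fml → ℕ → Set
AtomWith φ x = ∃ λ p → ∃ λ ts → AtomAt φ p ts × var x ∈ ts

FreeIn⇒Occurs : ∀ {x φ} → FreeIn x φ → Occurs x φ
FreeIn⇒Occurs (inLit x∈) = inLit x∈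
FreeIn⇒Occurs (inBL f)   = inBL (FreeIn⇒Occurs f)
FreeIn⇒Occurs (inBR f)   = inBR (FreeIn⇒Occurs f)
FreeIn⇒Occurs (inQ _ f)  = inQ (FreeIn⇒Occurs f)

AtomWith⇒Occurs : ∀ {x φ} → AtomWith φ x → Occurs x φ
AtomWith⇒Occurs (_ , _ , (_ , _ , sub) , x∈) = inside-literal sub x∈
  where
  inside-literal : ∀ {φ p s R ts x} → SubAt φ p (lit s R ts) → var x ∈ ts → Occurs x φ
  inside-literal here    x∈ = inLit x∈
  inside-literal (inL s) x∈ = inBL (inside-literal s x∈)
  inside-literal (inR s) x∈ = inBR (inside-literal s x∈)
  inside-literal (inQ s) x∈ = inQ (inside-literal s x∈)

AtomWith⊎Bound-inside : ∀ {φ ψ x} d → (∀ {p θ} → SubAt ψ p θ → SubAt φ (d ∷ p) θ)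
                      → AtomWith ψ x ⊎ Bound ψ x → AtomWith φ x ⊎ Bound φ x
AtomWith⊎Bound-inside d into (inj₁ (p , ts , (s , R , sub) , x∈)) = inj₁ (d ∷ p , ts , (s , R , into sub) , x∈)
AtomWith⊎Bound-inside d into (inj₂ (q , p , ψ , sub))             = inj₂ (q , d ∷ p , ψ , into sub)

Occurs⇒AtomWith⊎Bound : ∀ {x φ} → Occurs x φ → AtomWith φ x ⊎ Bound φ x
Occurs⇒AtomWith⊎Bound (inLit x∈) = inj₁ (_ , _ , (_ , _ , here) , x∈)
Occurs⇒AtomWith⊎Bound isQ        = inj₂ (_ , [] , _ , here)
Occurs⇒AtomWith⊎Bound (inBL o)   = AtomWith⊎Bound-inside left  inL (Occurs⇒AtomWith⊎Bound o)
Occurs⇒AtomWith⊎Bound (inBR o)   = AtomWith⊎Bound-inside right inR (Occurs⇒AtomWith⊎Bound o)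
Occurs⇒AtomWith⊎Bound (inQ o)    = AtomWith⊎Bound-inside down  inQ (Occurs⇒AtomWith⊎Bound o)

downs : ℕ → List Dir
downs k = replicate k down

∃-prefix : ℕ → Fml → Fml
∃-prefix zero    χ = χ
∃-prefix (suc k) χ = qu ex (suc k) (∃-prefix k χ)

∃-prefix-sub : ∀ k {χ p θ} → SubAt χ p θ → SubAt (∃-prefix k χ) (downs k ++ p) θ
∃-prefix-sub zero    s = s
∃-prefix-sub (suc k) s = inQ (∃-prefix-sub k s)

∃-prefix-literal : ∀ k {χ p s R ts} → SubAt (∃-prefix k χ) p (lit s R ts) → ∃ λ p' → SubAt χ p' (lit s R ts)
∃-prefix-literal zero    s       = _ , s
∃-prefix-literal (suc k) (inQ s) = ∃-prefix-literal k s

∃-prefix-quantifier : ∀ k {χ p q x ψ} → SubAt (∃-prefix k χ) p (qu q x ψ)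
                    → (∃ λ p' → SubAt χ p' (qu q x ψ) × p ≡ downs k ++ p')
                    ⊎ (0 < x × x ≤ k × q ≡ ex × p ≡ downs (k ∸ x))
∃-prefix-quantifier zero    s    = inj₁ (_ , s , refl)
∃-prefix-quantifier (suc k) here = inj₂ (z<s , ≤-refl , refl , cong downs (sym (n∸n≡0 k)))
∃-prefix-quantifier (suc k) (inQ s) with ∃-prefix-quantifier k s
... | inj₁ (p' , s' , refl)         = inj₁ (p' , s' , refl)
... | inj₂ (0<x , x≤k , refl , refl) =
  inj₂ (0<x , m≤n⇒m≤1+n x≤k , refl , cong downs (sym (+-∸-assoc 1 x≤k)))

∃-prefix-QOf : ∀ k {χ x} → 0 < x → x ≤ k → QOf (∃-prefix k χ) x ex
∃-prefix-QOf zero    (s≤s _) ()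
∃-prefix-QOf (suc k) {x = x} 0<x x≤k with x ≟ suc k
... | yes refl = [] , _ , here
... | no x≢k with ∃-prefix-QOf k 0<x (≤-pred (≤∧≢⇒< x≤k x≢k))
...   | p , ψ , s = down ∷ p , ψ , inQ s

∃-prefix-free : ∀ k {χ x} → FreeIn x (∃-prefix k χ) → FreeIn x χ × (x ≡ 0 ⊎ k < x)
∃-prefix-free zero {x = zero}  f = f , inj₁ refl
∃-prefix-free zero {x = suc x} f = f , inj₂ z<s
∃-prefix-free (suc k) (inQ x≢k f) with ∃-prefix-free k f
... | f' , inj₁ x≡0 = f' , inj₁ x≡0
... | f' , inj₂ k<x = f' , inj₂ (≤∧≢⇒< k<x (x≢k ∘ sym))

spoke-atom : ℕ → Fml
spoke-atom i = lit pos 0 (var i ∷ var 0 ∷ [])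

spoke-conj : ℕ → Fml
spoke-conj zero    = spoke-atom 1
spoke-conj (suc m) = bin and (spoke-atom (suc (suc m))) (spoke-conj m)

star-formula : ℕ → Fml
star-formula m = ∃-prefix (suc m) (qu all 0 (spoke-conj m))

∈-spoke : ∀ {x i} → var x ∈ (var i ∷ var 0 ∷ []) → x ≡ i ⊎ x ≡ 0
∈-spoke (here refl)         = inj₁ refl
∈-spoke (there (here refl)) = inj₂ refl

spoke-conj-quantifier-free : ∀ m {p q x ψ} → ¬ SubAt (spoke-conj m) p (qu q x ψ)
spoke-conj-quantifier-free zero    ()
spoke-conj-quantifier-free (suc m) (inL ())
spoke-conj-quantifier-free (suc m) (inR s) = spoke-conj-quantifier-free m s

spoke-conj-literal : ∀ m {p s R ts} → SubAt (spoke-conj m) p (lit s R ts)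
                   → ∃ λ j → j < suc m × ts ≡ var (suc j) ∷ var 0 ∷ []
spoke-conj-literal zero    here       = 0 , z<s , refl
spoke-conj-literal (suc m) (inL here) = suc m , ≤-refl , refl
spoke-conj-literal (suc m) (inR s) with j , j≤m , ts≡ ← spoke-conj-literal m s = j , m≤n⇒m≤1+n j≤m , ts≡

spoke-conj-atom : ∀ m {j} → j < suc m → ∃ λ p → SubAt (spoke-conj m) p (spoke-atom (suc j))
spoke-conj-atom zero    (s≤s z≤n) = [] , here
spoke-conj-atom (suc m) {j} j< with j ≟ suc m
... | yes refl = left ∷ [] , inL here
... | no j≢m with p , s ← spoke-conj-atom m (≤∧≢⇒< (≤-pred j<) j≢m) = right ∷ p , inR s

quantifier-of : ℕ → Quant
quantifier-of zero    = all
quantifier-of (suc _) = ex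

star-quantifier : ∀ m {p q x ψ} → SubAt (star-formula m) p (qu q x ψ)
                → p ≡ downs (suc m ∸ x)
                × ((x ≡ 0 × q ≡ all × ψ ≡ spoke-conj m) ⊎ (0 < x × x ≤ suc m × q ≡ ex))
star-quantifier m s with ∃-prefix-quantifier (suc m) s
... | inj₁ (_ , here , p≡)       = trans p≡ (++-identityʳ _) , inj₁ (refl , refl , refl)
... | inj₁ (_ , inQ s' , _)      = ⊥-elim (spoke-conj-quantifier-free m s')
... | inj₂ (0<x , x≤ , q≡ , p≡)  = p≡ , inj₂ (0<x , x≤ , q≡)

star-QOf : ∀ m {x q} → QOf (star-formula m) x q → q ≡ quantifier-of x
star-QOf m (_ , _ , s) with star-quantifier m s
... | _ , inj₁ (refl , refl , _)    = refl
... | _ , inj₂ (s≤s z≤n , _ , refl) = refl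

centre-QOf : ∀ m → QOf (star-formula m) 0 all
centre-QOf m = _ , _ , ∃-prefix-sub (suc m) here

leaf-QOf : ∀ m {j} → j < suc m → QOf (star-formula m) (suc j) ex
leaf-QOf m = ∃-prefix-QOf (suc m) z<s

star-literal : ∀ m {p ts} → AtomAt (star-formula m) p ts → ∃ λ j → j < suc m × ts ≡ var (suc j) ∷ var 0 ∷ []
star-literal m (_ , _ , s) with _ , inQ s' ← ∃-prefix-literal (suc m) s = spoke-conj-literal m s'

star-spoke : ∀ m {j} → j < suc m → ∃ λ p → AtomAt (star-formula m) p (var (suc j) ∷ var 0 ∷ [])
star-spoke m j< with p , s ← spoke-conj-atom m j< = _ , pos , 0 , ∃-prefix-sub (suc m) (inQ s)

star-occurs⇒≤ : ∀ m {x} → Occurs x (star-formula m) → x ≤ suc m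
star-occurs⇒≤ m o with Occurs⇒AtomWith⊎Bound o
... | inj₂ (_ , _ , _ , s) with star-quantifier m s
...   | _ , inj₁ (refl , _)     = z≤n
...   | _ , inj₂ (_ , x≤ , _)   = x≤
star-occurs⇒≤ m o | inj₁ (_ , _ , at , x∈) with star-literal m at
...   | _ , j< , refl with ∈-spoke x∈
...     | inj₁ refl = j<
...     | inj₂ refl = z≤n

≤⇒star-occurs : ∀ m {x} → x ≤ suc m → Occurs x (star-formula m)
≤⇒star-occurs m {zero}  _  = AtomWith⇒Occurs (_ , _ , proj₂ (star-spoke m z<s) , there (here refl))
≤⇒star-occurs m {suc _} j< = AtomWith⇒Occurs (_ , _ , proj₂ (star-spoke m j<) , here refl)

star-closed : ∀ m {x} → ¬ FreeIn x (star-formula m)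
star-closed m f with ∃-prefix-free (suc m) f
... | inQ x≢0 _ , inj₁ x≡0 = x≢0 x≡0
... | _         , inj₂ m<x = <⇒≱ m<x (star-occurs⇒≤ m (FreeIn⇒Occurs f))

star-straight : ∀ m → Straight (star-formula m)
star-straight m =
    (λ _ _ _ _ _ _ _ s s' → trans (proj₁ (star-quantifier m s)) (sym (proj₁ (star-quantifier m s'))))
  , (λ _ f _ → star-closed m f)
  , bound-in-atom
  where
  bound-in-atom : ∀ x → Bound (star-formula m) x → AtomWith (star-formula m) x
  bound-in-atom x (_ , _ , _ , s) with star-quantifier m s
  ... | _ , inj₁ (refl , _)         = _ , _ , proj₂ (star-spoke m z<s) , there (here refl)
  ... | _ , inj₂ (s≤s z≤n , j< , _) = _ , _ , proj₂ (star-spoke m j<) , here refl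

star-graph : ∀ m → Star (suc m) (G (star-formula m))
star-graph m = record
  { vertex⇒≤   = star-occurs⇒≤ m
  ; ≤⇒vertex   = ≤⇒star-occurs m
  ; spoke      = λ j< → (λ ()) , inj₂ (_ , _ , proj₂ (star-spoke m j<) , here refl , there (here refl))
  ; edge⇒spoke = edge⇒spoke
  }
  where
  edge⇒spoke : ∀ {u v} → Graph.E (G (star-formula m)) u v
             → ∃ λ j → j < suc m × ((u ≡ suc j × v ≡ 0) ⊎ (u ≡ 0 × v ≡ suc j))
  edge⇒spoke (_ , inj₁ (f , _)) = ⊥-elim (star-closed m f)
  edge⇒spoke (u≢v , inj₂ (_ , _ , at , u∈ , v∈)) with star-literal m at
  ... | j , j< , refl with ∈-spoke u∈ | ∈-spoke v∈
  ...   | inj₁ refl | inj₁ refl = ⊥-elim (u≢v refl)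
  ...   | inj₁ refl | inj₂ refl = j , j< , inj₁ (refl , refl)
  ...   | inj₂ refl | inj₁ refl = j , j< , inj₂ (refl , refl)
  ...   | inj₂ refl | inj₂ refl = ⊥-elim (u≢v refl)

_⊴₀_ : ℕ → ℕ → Set
x ⊴₀ y = x ≡ y ⊎ y ≡ 0

module _ (m : ℕ) where

  ⊴₀-closed : Closed (star-formula m) _⊴₀_
  ⊴₀-closed = (λ _ → inj₁ refl) , ⊴₀-trans , alternation-rule
    where
    ⊴₀-trans : ∀ x y z → x ⊴₀ y → y ⊴₀ z → x ⊴₀ z
    ⊴₀-trans _ _ _ _   (inj₂ z≡0) = inj₂ z≡0
    ⊴₀-trans _ _ _ x⊴y (inj₁ refl) = x⊴y
    alternation-rule : ∀ x y qx qy → x ≤[ star-formula m ] y → QOf (star-formula m) x qx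
                     → QOf (star-formula m) y qy → qx ≢ qy → EPath (star-formula m) _⊴₀_ x y x → x ⊴₀ y
    alternation-rule _ zero    _ _ _ _ _ _ _ = inj₂ refl
    alternation-rule _ (suc _) _ _ (inj₁ x≡y) _ _ _ _ = inj₁ x≡y
    alternation-rule _ (suc _) _ _ (inj₂ (_ , _ , _ , s , y-bound)) ox oy qx≢qy _ with star-quantifier m s
    ... | _ , inj₁ (refl , _ , refl) = ⊥-elim (spoke-conj-quantifier-free m (proj₂ (proj₂ (proj₂ y-bound))))
    ... | _ , inj₂ (s≤s z≤n , _) = ⊥-elim (qx≢qy (trans (star-QOf m ox) (sym (star-QOf m oy))))

  ⪯⇒⊴₀ : ∀ {x y} → x ⪯[ star-formula m ] y → x ⊴₀ y
  ⪯⇒⊴₀ x⪯y = x⪯y _⊴₀_ ⊴₀-closed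

  chain-from-centre : ∀ {x k} → Chain (star-formula m) 0 x k → x ≡ 0 × k ≡ 0
  chain-from-centre one = refl , refl
  chain-from-centre (step 0⪯w 0≢w _ _ _) with ⪯⇒⊴₀ 0⪯w
  ... | inj₁ 0≡w = ⊥-elim (0≢w 0≡w)
  ... | inj₂ w≡0 = ⊥-elim (0≢w (sym w≡0))

  chain-to-leaf : ∀ {v x k} → x ≢ 0 → Chain (star-formula m) v x k → v ≡ x × k ≡ 0
  chain-to-leaf _ one = refl , refl
  chain-to-leaf x≢0 (step v⪯w v≢w _ _ c) with ⪯⇒⊴₀ v⪯w
  ... | inj₁ v≡w  = ⊥-elim (v≢w v≡w)
  ... | inj₂ refl = ⊥-elim (x≢0 (proj₁ (chain-from-centre c)))

  chain-to-centre : ∀ {v k q} → Chain (star-formula m) v 0 k → QOf (star-formula m) v q → k + bonus q ≤ 2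
  chain-to-centre one o rewrite star-QOf m o = ≤-refl
  chain-to-centre {v} (step v⪯w v≢w ov ow c) o with ⪯⇒⊴₀ v⪯w
  ... | inj₁ v≡w = ⊥-elim (v≢w v≡w)
  ... | inj₂ refl with chain-from-centre c
  ...   | _ , refl rewrite star-QOf m ow | star-QOf m o | star-QOf m ov = alternation-bound (quantifier-of v)
    where
    alternation-bound : ∀ q → alt q all + 0 + bonus q ≤ 2
    alternation-bound ex  = ≤-refl
    alternation-bound all = ≤-refl

  ead-centre : Ead (star-formula m) 0 2
  ead-centre = inj₂ ( (all , centre-QOf m)
                    , (0 , all , 0 , centre-QOf m , one , refl)
                    , λ _ _ _ o c → chain-to-centre c o)

  ead-leaf : ∀ {j} → j < suc m → Ead (star-formula m) (suc j) 1
  ead-leaf {j} j< = inj₂ ( (ex , leaf-QOf m j<)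
                         , (suc j , ex , 0 , leaf-QOf m j< , one , refl)
                         , chain-bound)
    where
    chain-bound : ∀ v q k → QOf (star-formula m) v q → Chain (star-formula m) v (suc j) k → k + bonus q ≤ 1
    chain-bound _ _ _ o c with chain-to-leaf (λ ()) c
    ... | refl , refl rewrite star-QOf m o = ≤-refl

proposition3p16 : ∀ (n : ℕ) → 0 < n
    → Σ Fml λ φ → Straight φ × FotwIs φ n × TwIs (G φ) 1
proposition3p16 (suc m) _ =
    star-formula m
  , star-straight m
  , stratified-tw-star (star-graph m) (ead-centre m) (ead-leaf m) (s≤s (s≤s z≤n))
  , tw-star (star-graph m) z<s
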